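{- Let $p$ be an odd prime, $f$ a positive integer, and $d=p^f+1$. Let $K_d=\mathbb{F}_p(\mu_d,u)$ with $u^d=t$, let $E: y^2=x(x+1)(x+t)$, fix a primitive $d$-th root of unity $\zeta$, and let $P_i^{(d)}=(\zeta^i u,\ \zeta^i u(\zeta^i u+1)^{d/2})\in E(K_d)$ for $i=0,\ldots,d-1$. Then every non-torsion point $Q$ in the subgroup of $E(K_d)$ generated by $P_0^{(d)},\ldots,P_{d-1}^{(d)}$ satisfies $$\hat h(Q)\geq \frac{d-1}{2d}.$$
   Context: $\hat h$ denotes the Néron–Tate canonical height on $E(K_d)$, with associated bilinear form $\langle P,Q\rangle=\tfrac12(\hat h(P+Q)-\hat h(P)-\hat h(Q))$, so $\hat h(P)=\langle P,P\rangle$; it is positive definite on $E(K_d)$ modulo torsion. It is known (Ulmer) that $\langle P_i^{(d)},P_j^{(d)}\rangle$ equals $\frac{(d-1)(d-2)}{2d}$ if $i=j$, equals $\frac{1-d}{d}$ if $i\neq j$ and $i-j$ is even, and equals $0$ if $i-j$ is odd. -}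

module Defs where

open import Level using (_⊔_)
open import Function using (_∘_)
open import Algebra.Bundles using (AbelianGroup)
open import Data.Nat as ℕ using (ℕ; zero; suc; _^_; _∸_; _%_)
open import Data.Integer as ℤ using (ℤ; +_; -[1+_])
open import Data.Rational as ℚ using (ℚ; ½; 0ℚ)
open import Data.Fin using (Fin; toℕ)
open import Data.Product using (∃; _×_; Σ)
open import Relation.Nullary using (¬_)
open import Relation.Binary.PropositionalEquality using (_≡_; _≢_)

-- d = p^f + 1 (written as a successor so that it is visibly nonzero)
dOf : ℕ → ℕ → ℕ
dOf p f = suc (p ^ f)

module _ {c ℓ} (G : AbelianGroup c ℓ) where
  open AbelianGroup G renaming (Carrier to A)

  natMul : ℕ → A → A
  natMul zero    x = ε
  natMul (suc n) x = x ∙ natMul n x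

  intMul : ℤ → A → A
  intMul (+ n)    x = natMul n x
  intMul -[1+ n ] x = (natMul (suc n) x) ⁻¹

  IsTorsion : A → Set ℓ
  IsTorsion x = ∃ λ (n : ℕ) → n ≢ 0 × natMul n x ≈ ε

  linComb : (n : ℕ) → (Fin n → ℤ) → (Fin n → A) → A
  linComb zero    a P = ε
  linComb (suc n) a P = intMul (a Fin.zero) (P Fin.zero) ∙ linComb n (a ∘ Fin.suc) (P ∘ Fin.suc)
    where import Data.Fin as Fin

  InSubgroupGenBy : (n : ℕ) → (Fin n → A) → A → Set ℓ
  InSubgroupGenBy n P Q = ∃ λ (a : Fin n → ℤ) → Q ≈ linComb n a P

  pairing : (A → ℚ) → A → A → ℚ
  pairing ĥ P Q = ½ ℚ.* (ĥ (P ∙ Q) ℚ.- ĥ P ℚ.- ĥ Q)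

  -- Properties of the Néron–Tate canonical height used in the paper:
  -- it is a well-defined quadratic form on the group (parallelogram law),
  -- nonnegative, and vanishes exactly on torsion (positive definite mod torsion).
  record IsCanonicalHeight (ĥ : A → ℚ) : Set (c ⊔ ℓ) where
    field
      cong-ĥ        : ∀ {x y} → x ≈ y → ĥ x ≡ ĥ y
      parallelogram : ∀ x y → ĥ (x ∙ y) ℚ.+ ĥ (x ∙ y ⁻¹) ≡ (+ 2 ℚ./ 1) ℚ.* ĥ x ℚ.+ (+ 2 ℚ./ 1) ℚ.* ĥ y
      nonneg        : ∀ x → 0ℚ ℚ.≤ ĥ x
      zero⇒torsion  : ∀ x → ĥ x ≡ 0ℚ → IsTorsion x
      torsion⇒zero  : ∀ x → IsTorsion x → ĥ x ≡ 0ℚ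

  -- Ulmer's values of the pairing on P_0^{(d)}, …, P_{d-1}^{(d)}
  record UlmerPairing (ĥ : A → ℚ) (d : ℕ) .{{_ : ℕ.NonZero d}} (P : Fin d → A) : Set where
    field
      diag     : ∀ i → pairing ĥ (P i) (P i) ≡ ½ ℚ.* ((+ ((d ∸ 1) ℕ.* (d ∸ 2))) ℚ./ d)
      offEven  : ∀ i j → i ≢ j → (toℕ i ℕ.+ toℕ j) % 2 ≡ 0 → pairing ĥ (P i) (P j) ≡ (ℤ.- (+ (d ∸ 1))) ℚ./ d
      offOdd   : ∀ i j → (toℕ i ℕ.+ toℕ j) % 2 ≡ 1 → pairing ĥ (P i) (P j) ≡ 0ℚ

{-# OPTIONS --safe #-}
-- The three values of Ulmer's pairing are (d − 2)·c, −2c and 0 for c = (d − 1)/(2d),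
-- so they all lie in the cyclic group ℤc ⊆ ℚ. The canonical height is a quadratic form
-- (parallelogram law), hence ĥ(Σ aᵢPᵢ) = Σ aᵢaⱼ⟨Pᵢ,Pⱼ⟩ lies in ℤc as well. As ĥ is
-- nonnegative and vanishes only on torsion, a non-torsion Q has ĥ(Q) = kc with k ≥ 1.
module Submission where

open import Defs
open import Algebra.Bundles using (AbelianGroup)
open import Data.Nat using (ℕ; _≤_; _∸_; _*_)
open import Data.Nat.Primality using (Prime)
open import Data.Integer using (+_)
open import Data.Rational as ℚ using (ℚ)
open import Data.Fin using (Fin)
open import Relation.Nullary using (¬_)
open import Relation.Binary.PropositionalEquality using (_≢_)

open import Level using (0ℓ; _⊔_)
open import Data.Nat as ℕ using (suc; _+_; _%_; s≤s; s≤s⁻¹; z≤n)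
open import Data.Nat.Properties as ℕ using (n≤1⇒n≡0∨n≡1)
open import Data.Nat.DivMod using (m%n<n)
open import Data.Integer as ℤ using (ℤ; +0; +[1+_]; -[1+_])
import Data.Integer.Properties as ℤ
import Data.Integer.Tactic.RingSolver as ℤ-Solver
open import Data.Rational using (mkℚ; ½; 0ℚ; 1ℚ; toℚᵘ)
import Data.Rational.Properties as ℚ
import Data.Rational.Unnormalised as ℚᵘ
import Data.Rational.Unnormalised.Properties as ℚᵘ
open import Data.Nat.Coprimality using (1-coprimeTo) renaming (sym to coprime-sym)
open import Data.Fin as Fin using (toℕ)
open import Data.Fin.Properties using () renaming (_≟_ to _≟ᶠ_)
open import Data.Product using (∃; _,_)
open import Data.Sum using (_⊎_; inj₁; inj₂)
open import Data.Empty using (⊥-elim)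
open import Relation.Nullary using (yes; no)
open import Relation.Nullary.Decidable using (dec⇒maybe)
open import Relation.Binary.PropositionalEquality
  using (_≡_; refl; sym; trans; cong; cong₂; subst; subst₂; module ≡-Reasoning)
import Tactic.RingSolver as RingSolver
import Tactic.RingSolver.Core.AlmostCommutativeRing as ACR

ℚ-ring : ACR.AlmostCommutativeRing 0ℓ 0ℓ
ℚ-ring = ACR.fromCommutativeRing ℚ.+-*-commutativeRing (λ x → dec⇒maybe (0ℚ ℚ.≟ x))

2ℚ : ℚ
2ℚ = + 2 ℚ./ 1

+-minusˡ : ∀ a b → b ≡ (a ℚ.+ b) ℚ.- a
+-minusˡ = RingSolver.solve-∀ ℚ-ring

%2≡0⊎%2≡1 : ∀ m → m % 2 ≡ 0 ⊎ m % 2 ≡ 1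
%2≡0⊎%2≡1 m = n≤1⇒n≡0∨n≡1 (s≤s⁻¹ (m%n<n m 2))

fromℤ : ℤ → ℚ
fromℤ k = mkℚ k 0 (coprime-sym (1-coprimeTo ℤ.∣ k ∣))

fromℤ≡/1 : ∀ k → k ℚ./ 1 ≡ fromℤ k
fromℤ≡/1 k = ℚ.fromℚᵘ-toℚᵘ (fromℤ k)

fromℤ-homo-+ : ∀ i j → fromℤ (i ℤ.+ j) ≡ fromℤ i ℚ.+ fromℤ j
fromℤ-homo-+ i j = ℚ.toℚᵘ-injective
  (ℚᵘ.≃-trans (ℚᵘ.*≡* (cross i j)) (ℚᵘ.≃-sym (ℚ.toℚᵘ-homo-+ (fromℤ i) (fromℤ j))))
  where
  cross : ∀ i j → (i ℤ.+ j) ℤ.* + 1 ≡ (i ℤ.* + 1 ℤ.+ j ℤ.* + 1) ℤ.* + 1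
  cross = ℤ-Solver.solve-∀

fromℤ-homo‿- : ∀ k → fromℤ (ℤ.- k) ≡ ℚ.- fromℤ k
fromℤ-homo‿- +0       = refl
fromℤ-homo‿- +[1+ n ] = refl
fromℤ-homo‿- -[1+ n ] = refl

fromℤ-mono-≤ : ∀ {i j} → i ℤ.≤ j → fromℤ i ℚ.≤ fromℤ j
fromℤ-mono-≤ {i} {j} i≤j =
  ℚ.*≤* (subst₂ ℤ._≤_ (sym (ℤ.*-identityʳ i)) (sym (ℤ.*-identityʳ j)) i≤j)

/-homo-* : ∀ i j m n → (i ℚ./ suc m) ℚ.* (j ℚ./ suc n) ≡ (i ℤ.* j) ℚ./ (suc m * suc n)
/-homo-* i j m n = ℚ.toℚᵘ-injective (begin
  toℚᵘ ((i ℚ./ suc m) ℚ.* (j ℚ./ suc n))      ≈⟨ ℚ.toℚᵘ-homo-* (i ℚ./ suc m) (j ℚ./ suc n) ⟩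
  toℚᵘ (i ℚ./ suc m) ℚᵘ.* toℚᵘ (j ℚ./ suc n)  ≈⟨ ℚᵘ.*-cong (ℚ.toℚᵘ-fromℚᵘ (ℚᵘ.mkℚᵘ i m))
                                                           (ℚ.toℚᵘ-fromℚᵘ (ℚᵘ.mkℚᵘ j n)) ⟩
  ℚᵘ.mkℚᵘ i m ℚᵘ.* ℚᵘ.mkℚᵘ j n                 ≈⟨ ℚᵘ.≃-sym (ℚ.toℚᵘ-fromℚᵘ (ℚᵘ.mkℚᵘ i m ℚᵘ.* ℚᵘ.mkℚᵘ j n)) ⟩
  toℚᵘ ((i ℤ.* j) ℚ./ (suc m * suc n))         ∎)
  where open ℚᵘ.≃-Reasoning

/-≡-cross : ∀ i j m n → i ℤ.* + suc n ≡ j ℤ.* + suc m → i ℚ./ suc m ≡ j ℚ./ suc n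
/-≡-cross i j m n eq = ℚ.fromℚᵘ-cong {ℚᵘ.mkℚᵘ i m} {ℚᵘ.mkℚᵘ j n} (ℚᵘ.*≡* eq)

fromℤ-*-/ : ∀ k j n → fromℤ k ℚ.* (j ℚ./ suc n) ≡ (k ℤ.* j) ℚ./ suc n
fromℤ-*-/ k j n = begin
  fromℤ k ℚ.* (j ℚ./ suc n)        ≡⟨ cong (ℚ._* (j ℚ./ suc n)) (sym (fromℤ≡/1 k)) ⟩
  (k ℚ./ 1) ℚ.* (j ℚ./ suc n)      ≡⟨ /-homo-* k j 0 n ⟩
  (k ℤ.* j) ℚ./ (1 * suc n)        ≡⟨ ℚ./-cong {k ℤ.* j} refl (ℕ.*-identityˡ (suc n)) ⟩
  (k ℤ.* j) ℚ./ suc n              ∎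
  where open ≡-Reasoning

module _ {c ℓ} (G : AbelianGroup c ℓ) where
  open AbelianGroup G using (_∙_; ε; _⁻¹) renaming (Carrier to A)

  record IsSubgroup {p} (S : A → Set p) : Set (c ⊔ p) where
    field
      ε-closed  : S ε
      ∙-closed  : ∀ {x y} → S x → S y → S (x ∙ y)
      ⁻¹-closed : ∀ {x} → S x → S (x ⁻¹)

  module _ {p} {S : A → Set p} (S-subgroup : IsSubgroup S) where
    open IsSubgroup S-subgroup

    natMul-closed : ∀ n {x} → S x → S (natMul G n x)
    natMul-closed ℕ.zero    Sx = ε-closed
    natMul-closed (suc n) Sx = ∙-closed Sx (natMul-closed n Sx)

    intMul-closed : ∀ k {x} → S x → S (intMul G k x)
    intMul-closed (+ n)    Sx = natMul-closed n Sx
    intMul-closed -[1+ n ] Sx = ⁻¹-closed (natMul-closed (suc n) Sx)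

    linComb-closed : ∀ n a (P : Fin n → A) → (∀ i → S (P i)) → S (linComb G n a P)
    linComb-closed ℕ.zero    a P SP = ε-closed
    linComb-closed (suc n) a P SP =
      ∙-closed (intMul-closed (a Fin.zero) (SP Fin.zero))
               (linComb-closed n (λ i → a (Fin.suc i)) (λ i → P (Fin.suc i)) (λ i → SP (Fin.suc i)))

module _ {c ℓ} (G : AbelianGroup c ℓ) where
  open AbelianGroup G renaming (Carrier to A; sym to ≈-sym) hiding (refl; trans)

  module ParallelogramLaw (q : A → ℚ) (q-cong : ∀ {x y} → x ≈ y → q x ≡ q y)
    (parallelogram : ∀ x y → q (x ∙ y) ℚ.+ q (x ∙ y ⁻¹) ≡ 2ℚ ℚ.* q x ℚ.+ 2ℚ ℚ.* q y)
    where

    open import Algebra.Properties.Group group using (⁻¹-anti-homo-//)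
    open ≡-Reasoning

    ⟨_,_⟩ : A → A → ℚ
    ⟨_,_⟩ = pairing G q

    q-ε : q ε ≡ 0ℚ
    q-ε = begin
      q ε                                                      ≡⟨ halve-double (q ε) ⟩
      ½ ℚ.* ((2ℚ ℚ.* q ε ℚ.+ 2ℚ ℚ.* q ε) ℚ.- (q ε ℚ.+ q ε))  ≡⟨ cong (λ t → ½ ℚ.* (t ℚ.- (q ε ℚ.+ q ε))) (sym εε) ⟩
      ½ ℚ.* ((q ε ℚ.+ q ε) ℚ.- (q ε ℚ.+ q ε))                 ≡⟨ cancel (q ε ℚ.+ q ε) ⟩
      0ℚ                                                       ∎
      where
      εε : q ε ℚ.+ q ε ≡ 2ℚ ℚ.* q ε ℚ.+ 2ℚ ℚ.* q ε
      εε = trans (cong₂ ℚ._+_ (q-cong (≈-sym (identityʳ ε))) (q-cong (≈-sym (inverseʳ ε)))) (parallelogram ε ε)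
      halve-double : ∀ x → x ≡ ½ ℚ.* ((2ℚ ℚ.* x ℚ.+ 2ℚ ℚ.* x) ℚ.- (x ℚ.+ x))
      halve-double = RingSolver.solve-∀ ℚ-ring
      cancel : ∀ x → ½ ℚ.* (x ℚ.- x) ≡ 0ℚ
      cancel = RingSolver.solve-∀ ℚ-ring

    q-⁻¹ : ∀ x → q (x ⁻¹) ≡ q x
    q-⁻¹ x = begin
      q (x ⁻¹)                                   ≡⟨ +-minusˡ (q x) (q (x ⁻¹)) ⟩
      (q x ℚ.+ q (x ⁻¹)) ℚ.- q x                 ≡⟨ cong (ℚ._- q x) εx ⟩
      (2ℚ ℚ.* 0ℚ ℚ.+ 2ℚ ℚ.* q x) ℚ.- q x         ≡⟨ simplify (q x) ⟩
      q x                                        ∎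
      where
      εx : q x ℚ.+ q (x ⁻¹) ≡ 2ℚ ℚ.* 0ℚ ℚ.+ 2ℚ ℚ.* q x
      εx = begin
        q x ℚ.+ q (x ⁻¹)                    ≡⟨ cong₂ ℚ._+_ (q-cong (≈-sym (identityˡ x))) (q-cong (≈-sym (identityˡ (x ⁻¹)))) ⟩
        q (ε ∙ x) ℚ.+ q (ε ∙ x ⁻¹)          ≡⟨ parallelogram ε x ⟩
        2ℚ ℚ.* q ε ℚ.+ 2ℚ ℚ.* q x           ≡⟨ cong (λ t → 2ℚ ℚ.* t ℚ.+ 2ℚ ℚ.* q x) q-ε ⟩
        2ℚ ℚ.* 0ℚ ℚ.+ 2ℚ ℚ.* q x           ∎
      simplify : ∀ a → (2ℚ ℚ.* 0ℚ ℚ.+ 2ℚ ℚ.* a) ℚ.- a ≡ a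
      simplify = RingSolver.solve-∀ ℚ-ring

    pairing-comm : ∀ x y → ⟨ x , y ⟩ ≡ ⟨ y , x ⟩
    pairing-comm x y = trans (cong (λ t → ½ ℚ.* (t ℚ.- q x ℚ.- q y)) (q-cong (comm x y))) (swap (q (y ∙ x)) (q x) (q y))
      where
      swap : ∀ s a b → ½ ℚ.* (s ℚ.- a ℚ.- b) ≡ ½ ℚ.* (s ℚ.- b ℚ.- a)
      swap = RingSolver.solve-∀ ℚ-ring

    pairing-congʳ : ∀ x {y y′} → y ≈ y′ → ⟨ x , y ⟩ ≡ ⟨ x , y′ ⟩
    pairing-congʳ x y≈y′ = cong₂ (λ s t → ½ ℚ.* (s ℚ.- q x ℚ.- t)) (q-cong (∙-congˡ y≈y′)) (q-cong y≈y′)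

    pairing-εʳ : ∀ x → ⟨ x , ε ⟩ ≡ 0ℚ
    pairing-εʳ x = begin
      ½ ℚ.* (q (x ∙ ε) ℚ.- q x ℚ.- q ε)   ≡⟨ cong₂ (λ s t → ½ ℚ.* (s ℚ.- q x ℚ.- t)) (q-cong (identityʳ x)) q-ε ⟩
      ½ ℚ.* (q x ℚ.- q x ℚ.- 0ℚ)         ≡⟨ cancel (q x) ⟩
      0ℚ                                 ∎
      where
      cancel : ∀ a → ½ ℚ.* (a ℚ.- a ℚ.- 0ℚ) ≡ 0ℚ
      cancel = RingSolver.solve-∀ ℚ-ring

    pairing-⁻¹ʳ : ∀ x y → ⟨ x , y ⁻¹ ⟩ ≡ ℚ.- ⟨ x , y ⟩
    pairing-⁻¹ʳ x y = begin
      ½ ℚ.* (q (x ∙ y ⁻¹) ℚ.- q x ℚ.- q (y ⁻¹))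
        ≡⟨ cong (λ t → ½ ℚ.* (q (x ∙ y ⁻¹) ℚ.- q x ℚ.- t)) (q-⁻¹ y) ⟩
      ½ ℚ.* (q (x ∙ y ⁻¹) ℚ.- q x ℚ.- q y)
        ≡⟨ cong (λ t → ½ ℚ.* (t ℚ.- q x ℚ.- q y)) (+-minusˡ (q (x ∙ y)) (q (x ∙ y ⁻¹))) ⟩
      ½ ℚ.* ((q (x ∙ y) ℚ.+ q (x ∙ y ⁻¹)) ℚ.- q (x ∙ y) ℚ.- q x ℚ.- q y)
        ≡⟨ cong (λ t → ½ ℚ.* (t ℚ.- q (x ∙ y) ℚ.- q x ℚ.- q y)) (parallelogram x y) ⟩
      ½ ℚ.* ((2ℚ ℚ.* q x ℚ.+ 2ℚ ℚ.* q y) ℚ.- q (x ∙ y) ℚ.- q x ℚ.- q y)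
        ≡⟨ simplify (q (x ∙ y)) (q x) (q y) ⟩
      ℚ.- ⟨ x , y ⟩
        ∎
      where
      simplify : ∀ s a b → ½ ℚ.* ((2ℚ ℚ.* a ℚ.+ 2ℚ ℚ.* b) ℚ.- s ℚ.- a ℚ.- b) ≡ ℚ.- (½ ℚ.* (s ℚ.- a ℚ.- b))
      simplify = RingSolver.solve-∀ ℚ-ring

    pairing-∙∙⁻¹ʳ : ∀ x y z → ⟨ x , y ∙ z ⟩ ℚ.+ ⟨ x , y ∙ z ⁻¹ ⟩ ≡ 2ℚ ℚ.* ⟨ x , y ⟩
    pairing-∙∙⁻¹ʳ x y z = begin
      ⟨ x , y ∙ z ⟩ ℚ.+ ⟨ x , y ∙ z ⁻¹ ⟩
        ≡⟨ regroup (q (x ∙ (y ∙ z))) (q (x ∙ (y ∙ z ⁻¹))) (q (y ∙ z)) (q (y ∙ z ⁻¹)) (q x) ⟩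
      ½ ℚ.* ((q (x ∙ (y ∙ z)) ℚ.+ q (x ∙ (y ∙ z ⁻¹))) ℚ.- (q (y ∙ z) ℚ.+ q (y ∙ z ⁻¹))) ℚ.- q x
        ≡⟨ cong₂ (λ s t → ½ ℚ.* (s ℚ.- t) ℚ.- q x) outer (parallelogram y z) ⟩
      ½ ℚ.* ((2ℚ ℚ.* q (x ∙ y) ℚ.+ 2ℚ ℚ.* q z) ℚ.- (2ℚ ℚ.* q y ℚ.+ 2ℚ ℚ.* q z)) ℚ.- q x
        ≡⟨ collect (q (x ∙ y)) (q x) (q y) (q z) ⟩
      2ℚ ℚ.* ⟨ x , y ⟩
        ∎
      where
      outer : q (x ∙ (y ∙ z)) ℚ.+ q (x ∙ (y ∙ z ⁻¹)) ≡ 2ℚ ℚ.* q (x ∙ y) ℚ.+ 2ℚ ℚ.* q z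
      outer = trans (cong₂ ℚ._+_ (q-cong (≈-sym (assoc x y z))) (q-cong (≈-sym (assoc x y (z ⁻¹)))))
                    (parallelogram (x ∙ y) z)
      regroup : ∀ a b s t u → ½ ℚ.* (a ℚ.- u ℚ.- s) ℚ.+ ½ ℚ.* (b ℚ.- u ℚ.- t) ≡ ½ ℚ.* ((a ℚ.+ b) ℚ.- (s ℚ.+ t)) ℚ.- u
      regroup = RingSolver.solve-∀ ℚ-ring
      collect : ∀ w u v r → ½ ℚ.* ((2ℚ ℚ.* w ℚ.+ 2ℚ ℚ.* r) ℚ.- (2ℚ ℚ.* v ℚ.+ 2ℚ ℚ.* r)) ℚ.- u ≡ 2ℚ ℚ.* (½ ℚ.* (w ℚ.- u ℚ.- v))
      collect = RingSolver.solve-∀ ℚ-ring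

    -- Adding the instances (y, z) and (z, y) of pairing-∙∙⁻¹ʳ cancels the ⟨ x , y ∙ z ⁻¹ ⟩ terms.
    pairing-∙ʳ : ∀ x y z → ⟨ x , y ∙ z ⟩ ≡ ⟨ x , y ⟩ ℚ.+ ⟨ x , z ⟩
    pairing-∙ʳ x y z = begin
      ⟨ x , y ∙ z ⟩
        ≡⟨ average ⟨ x , y ∙ z ⟩ ⟨ x , y ∙ z ⁻¹ ⟩ ⟩
      ½ ℚ.* ((⟨ x , y ∙ z ⟩ ℚ.+ ⟨ x , y ∙ z ⁻¹ ⟩) ℚ.+ (⟨ x , y ∙ z ⟩ ℚ.+ ℚ.- ⟨ x , y ∙ z ⁻¹ ⟩))
        ≡⟨ cong₂ (λ s t → ½ ℚ.* (s ℚ.+ t)) (pairing-∙∙⁻¹ʳ x y z) swapped ⟩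
      ½ ℚ.* (2ℚ ℚ.* ⟨ x , y ⟩ ℚ.+ 2ℚ ℚ.* ⟨ x , z ⟩)
        ≡⟨ halve (⟨ x , y ⟩) (⟨ x , z ⟩) ⟩
      ⟨ x , y ⟩ ℚ.+ ⟨ x , z ⟩
        ∎
      where
      swapped : ⟨ x , y ∙ z ⟩ ℚ.+ ℚ.- ⟨ x , y ∙ z ⁻¹ ⟩ ≡ 2ℚ ℚ.* ⟨ x , z ⟩
      swapped = begin
        ⟨ x , y ∙ z ⟩ ℚ.+ ℚ.- ⟨ x , y ∙ z ⁻¹ ⟩
          ≡⟨ cong (⟨ x , y ∙ z ⟩ ℚ.+_) (sym (pairing-⁻¹ʳ x (y ∙ z ⁻¹))) ⟩
        ⟨ x , y ∙ z ⟩ ℚ.+ ⟨ x , (y ∙ z ⁻¹) ⁻¹ ⟩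
          ≡⟨ cong₂ ℚ._+_ (pairing-congʳ x (comm y z)) (pairing-congʳ x (⁻¹-anti-homo-// y z)) ⟩
        ⟨ x , z ∙ y ⟩ ℚ.+ ⟨ x , z ∙ y ⁻¹ ⟩
          ≡⟨ pairing-∙∙⁻¹ʳ x z y ⟩
        2ℚ ℚ.* ⟨ x , z ⟩
          ∎
      average : ∀ s t → s ≡ ½ ℚ.* ((s ℚ.+ t) ℚ.+ (s ℚ.+ ℚ.- t))
      average = RingSolver.solve-∀ ℚ-ring
      halve : ∀ a b → ½ ℚ.* (2ℚ ℚ.* a ℚ.+ 2ℚ ℚ.* b) ≡ a ℚ.+ b
      halve = RingSolver.solve-∀ ℚ-ring

    pairing-self : ∀ x → ⟨ x , x ⟩ ≡ q x
    pairing-self x = begin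
      ½ ℚ.* (q (x ∙ x) ℚ.- q x ℚ.- q x)                                     ≡⟨ cong (λ t → ½ ℚ.* (t ℚ.- q x ℚ.- q x)) xx ⟩
      ½ ℚ.* ((2ℚ ℚ.* q x ℚ.+ 2ℚ ℚ.* q x) ℚ.- q x ℚ.- q x)                  ≡⟨ simplify (q x) ⟩
      q x                                                                   ∎
      where
      xx : q (x ∙ x) ≡ 2ℚ ℚ.* q x ℚ.+ 2ℚ ℚ.* q x
      xx = begin
        q (x ∙ x)                      ≡⟨ sym (ℚ.+-identityʳ (q (x ∙ x))) ⟩
        q (x ∙ x) ℚ.+ 0ℚ               ≡⟨ cong (q (x ∙ x) ℚ.+_) (sym (trans (q-cong (inverseʳ x)) q-ε)) ⟩
        q (x ∙ x) ℚ.+ q (x ∙ x ⁻¹)     ≡⟨ parallelogram x x ⟩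
        2ℚ ℚ.* q x ℚ.+ 2ℚ ℚ.* q x      ∎
      simplify : ∀ a → ½ ℚ.* ((2ℚ ℚ.* a ℚ.+ 2ℚ ℚ.* a) ℚ.- a ℚ.- a) ≡ a
      simplify = RingSolver.solve-∀ ℚ-ring

    module _ {Λ : ℚ → Set} (Λ-subgroup : IsSubgroup ℚ.+-0-abelianGroup Λ) where
      open IsSubgroup Λ-subgroup

      pairing-preimage-isSubgroup : ∀ x → IsSubgroup G (λ y → Λ ⟨ x , y ⟩)
      pairing-preimage-isSubgroup x = record
        { ε-closed  = subst Λ (sym (pairing-εʳ x)) ε-closed
        ; ∙-closed  = λ {y} {z} Λy Λz → subst Λ (sym (pairing-∙ʳ x y z)) (∙-closed Λy Λz)
        ; ⁻¹-closed = λ {y} Λy → subst Λ (sym (pairing-⁻¹ʳ x y)) (⁻¹-closed Λy)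
        }

      q-linComb-closed : ∀ n (P : Fin n → A) → (∀ i j → Λ ⟨ P i , P j ⟩) → ∀ a → Λ (q (linComb G n a P))
      q-linComb-closed n P ΛPP a = subst Λ (pairing-self L) (linComb-closed G (pairing-preimage-isSubgroup L) n a P ΛLP)
        where
        L : A
        L = linComb G n a P
        ΛLP : ∀ i → Λ ⟨ L , P i ⟩
        ΛLP i = subst Λ (pairing-comm (P i) L) (linComb-closed G (pairing-preimage-isSubgroup (P i)) n a P (ΛPP i))

IntMultiple : ℚ → ℚ → Set
IntMultiple c r = ∃ λ k → r ≡ fromℤ k ℚ.* c

intMultiple-isSubgroup : ∀ c → IsSubgroup ℚ.+-0-abelianGroup (IntMultiple c)
intMultiple-isSubgroup c = record
  { ε-closed  = + 0 , sym (ℚ.*-zeroˡ c)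
  ; ∙-closed  = λ { (k , r≡kc) (l , s≡lc) → k ℤ.+ l ,
      trans (cong₂ ℚ._+_ r≡kc s≡lc)
            (trans (sym (ℚ.*-distribʳ-+ c (fromℤ k) (fromℤ l))) (cong (ℚ._* c) (sym (fromℤ-homo-+ k l)))) }
  ; ⁻¹-closed = λ { (k , r≡kc) → ℤ.- k ,
      trans (cong ℚ.-_ r≡kc)
            (trans (ℚ.neg-distribˡ-* (fromℤ k) c) (cong (ℚ._* c) (sym (fromℤ-homo‿- k)))) }
  }

nonZero-intMultiple-≥ : ∀ {c r} → 0ℚ ℚ.≤ c → IntMultiple c r → 0ℚ ℚ.≤ r → r ≢ 0ℚ → c ℚ.≤ r
nonZero-intMultiple-≥ {c} {r} 0≤c (+[1+ m ] , r≡kc) _ _ = begin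
  c                      ≡⟨ sym (ℚ.*-identityˡ c) ⟩
  1ℚ ℚ.* c               ≤⟨ ℚ.*-monoʳ-≤-nonNeg c {{ℚ.nonNegative 0≤c}} (fromℤ-mono-≤ (ℤ.+≤+ (s≤s z≤n))) ⟩
  fromℤ +[1+ m ] ℚ.* c   ≡⟨ sym r≡kc ⟩
  r                      ∎
  where open ℚ.≤-Reasoning
nonZero-intMultiple-≥ {c} _ (+0 , r≡0c) _ r≢0 = ⊥-elim (r≢0 (trans r≡0c (ℚ.*-zeroˡ c)))
nonZero-intMultiple-≥ {c} {r} 0≤c (-[1+ m ] , r≡kc) 0≤r r≢0 = ⊥-elim (r≢0 (ℚ.≤-antisym r≤0 0≤r))
  where
  open ℚ.≤-Reasoning
  r≤0 : r ℚ.≤ 0ℚ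
  r≤0 = begin
    r                       ≡⟨ r≡kc ⟩
    fromℤ -[1+ m ] ℚ.* c    ≤⟨ ℚ.*-monoʳ-≤-nonNeg c {{ℚ.nonNegative 0≤c}} (fromℤ-mono-≤ ℤ.-≤+) ⟩
    0ℚ ℚ.* c                ≡⟨ ℚ.*-zeroˡ c ⟩
    0ℚ                      ∎

ulmer-diag≡ : ∀ n m → ½ ℚ.* (+ (n * m) ℚ./ suc n) ≡ fromℤ (+ m) ℚ.* (+ n ℚ./ (2 * suc n))
ulmer-diag≡ n m = begin
  ½ ℚ.* (+ (n * m) ℚ./ suc n)               ≡⟨ /-homo-* (+ 1) (+ (n * m)) 1 n ⟩
  (+ 1 ℤ.* + (n * m)) ℚ./ (2 * suc n)       ≡⟨ ℚ./-cong numerators refl ⟩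
  (+ m ℤ.* + n) ℚ./ (2 * suc n)             ≡⟨ sym (fromℤ-*-/ (+ m) (+ n) _) ⟩
  fromℤ (+ m) ℚ.* (+ n ℚ./ (2 * suc n))     ∎
  where
  open ≡-Reasoning
  numerators : + 1 ℤ.* + (n * m) ≡ + m ℤ.* + n
  numerators = trans (ℤ.*-identityˡ (+ (n * m))) (trans (ℤ.pos-* n m) (ℤ.*-comm (+ n) (+ m)))

ulmer-offDiag≡ : ∀ n → ℤ.- + n ℚ./ suc n ≡ fromℤ -[1+ 1 ] ℚ.* (+ n ℚ./ (2 * suc n))
ulmer-offDiag≡ n = begin
  ℤ.- + n ℚ./ suc n                          ≡⟨ /-≡-cross (ℤ.- + n) (-[1+ 1 ] ℤ.* + n) n _ cross ⟩
  (-[1+ 1 ] ℤ.* + n) ℚ./ (2 * suc n)        ≡⟨ sym (fromℤ-*-/ -[1+ 1 ] (+ n) _) ⟩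
  fromℤ -[1+ 1 ] ℚ.* (+ n ℚ./ (2 * suc n))  ∎
  where
  open ≡-Reasoning
  cross : ℤ.- + n ℤ.* + (2 * suc n) ≡ -[1+ 1 ] ℤ.* + n ℤ.* + suc n
  cross = trans (cong (ℤ.- + n ℤ.*_) (ℤ.pos-* 2 (suc n))) (rearrange (+ n) (+ suc n))
    where
    rearrange : ∀ a s → ℤ.- a ℤ.* (+ 2 ℤ.* s) ≡ -[1+ 1 ] ℤ.* a ℤ.* s
    rearrange = ℤ-Solver.solve-∀

ulmer-pairing-intMultiple : ∀ {c ℓ} (G : AbelianGroup c ℓ) (ĥ : AbelianGroup.Carrier G → ℚ) n
  (P : Fin (suc n) → AbelianGroup.Carrier G) → UlmerPairing G ĥ (suc n) P →
  ∀ i j → IntMultiple (+ n ℚ./ (2 * suc n)) (pairing G ĥ (P i) (P j))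
ulmer-pairing-intMultiple G ĥ n P ulmer i j with %2≡0⊎%2≡1 (toℕ i + toℕ j)
... | inj₂ odd = + 0 , trans (UlmerPairing.offOdd ulmer i j odd) (sym (ℚ.*-zeroˡ (+ n ℚ./ (2 * suc n))))
... | inj₁ even with i ≟ᶠ j
...   | yes refl = + (n ∸ 1) , trans (UlmerPairing.diag ulmer i) (ulmer-diag≡ n (n ∸ 1))
...   | no i≢j   = -[1+ 1 ] , trans (UlmerPairing.offEven ulmer i j i≢j even) (ulmer-offDiag≡ n)

ulmer-height-≥ : ∀ n {c ℓ} (G : AbelianGroup c ℓ) (ĥ : AbelianGroup.Carrier G → ℚ) →
  IsCanonicalHeight G ĥ →
  (P : Fin (suc n) → AbelianGroup.Carrier G) → UlmerPairing G ĥ (suc n) P →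
  (Q : AbelianGroup.Carrier G) → InSubgroupGenBy G (suc n) P Q → ¬ IsTorsion G Q →
  + n ℚ./ (2 * suc n) ℚ.≤ ĥ Q
ulmer-height-≥ n G ĥ height P ulmer Q (a , Q≈aP) non-torsion =
  nonZero-intMultiple-≥ c≥0 ĥQ-multiple (nonneg Q) (λ ĥQ≡0 → non-torsion (zero⇒torsion Q ĥQ≡0))
  where
  open IsCanonicalHeight height
  open ParallelogramLaw G ĥ cong-ĥ parallelogram
  c : ℚ
  c = + n ℚ./ (2 * suc n)
  c≥0 : 0ℚ ℚ.≤ c
  c≥0 = ℚ.nonNegative⁻¹ c {{ℚ.normalize-nonNeg n (2 * suc n)}}
  ĥQ-multiple : IntMultiple c (ĥ Q)
  ĥQ-multiple = subst (IntMultiple c) (sym (cong-ĥ Q≈aP))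
    (q-linComb-closed (intMultiple-isSubgroup c) (suc n) P (ulmer-pairing-intMultiple G ĥ n P ulmer) a)

-- Only the pairing values enter, so p, f and their hypotheses play no role beyond fixing d.
proposition5p4 : (p f : ℕ) → Prime p → p ≢ 2 → 1 ≤ f →
    ∀ {c ℓ} (G : AbelianGroup c ℓ) (ĥ : AbelianGroup.Carrier G → ℚ) →
    IsCanonicalHeight G ĥ →
    (P : Fin (dOf p f) → AbelianGroup.Carrier G) → UlmerPairing G ĥ (dOf p f) P →
    (Q : AbelianGroup.Carrier G) → InSubgroupGenBy G (dOf p f) P Q → ¬ IsTorsion G Q →
    (+ (dOf p f ∸ 1)) ℚ./ (2 * dOf p f) ℚ.≤ ĥ Q
proposition5p4 p f _ _ _ = ulmer-height-≥ (p ℕ.^ f)
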